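{- For all integers $n,k,m,i\geq 0$, $$\sum_{j=0}^{n}\binom{n}{j}A_{k+j,k}(n-j)!=\sum_{j=0}^{n}\binom{n}{j}B_{k+j}D_{n-j},$$ $$\sum_{j=0}^{n}(-1)^{n-j}\binom{n}{j}A_{k+j,k}A_{m+i+j,m}=\sum_{j=0}^{n}(-1)^{n-j}\binom{n}{j}A_{n+m+i,n+m-j}B_{k+j},$$ where $D_n$ is the number of permutations of $\{1,\dots,n\}$ without fixed points ($D_0=1$).
   Context: A partition of a finite set is a collection of nonempty, pairwise disjoint subsets (blocks) whose union is the set; a singleton of a partition is a block with exactly one element. $B_n$ denotes the $n$-th Bell number ($B_0=1$). For integers $0\leq k\leq n$, $A_{n,k}$ denotes the number of partitions of $\{1,2,\dots,n+1\}$ whose largest singleton is $k+1$ (i.e. $\{k+1\}$ is a block and no $j>k+1$ forms a singleton block). -}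

module Defs where

open import Data.Bool using (Bool; true; false; _∧_; _∨_; not; if_then_else_)
open import Data.Nat using (ℕ; zero; suc; _≡ᵇ_; _<ᵇ_)
open import Data.Fin using (Fin; toℕ)
open import Data.Fin.Subset using (Subset; ⁅_⁆)
open import Data.Vec using (Vec; []; _∷_; lookup)
open import Data.List using (List; []; _∷_; [_]; map; concatMap; allFin; length; filterᵇ; foldr; upTo)
open import Data.Bool.ListAction using (all; any)
open import Data.Integer using (ℤ) renaming (_+_ to _+ℤ_; +_ to ⁺_)

allVecs : ∀ {a} {A : Set a} → List A → (m : ℕ) → List (Vec A m)
allVecs xs zero    = [ [] ]
allVecs xs (suc m) = concatMap (λ x → map (x ∷_) (allVecs xs m)) xs

allSubsets : (n : ℕ) → List (Subset n)
allSubsets n = allVecs (true ∷ false ∷ []) n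

countᵇ : ∀ {a} {A : Set a} → (A → Bool) → List A → ℕ
countᵇ p xs = length (filterᵇ p xs)

_==ˢ_ : ∀ {n} → Subset n → Subset n → Bool
[] ==ˢ [] = true
(x ∷ xs) ==ˢ (y ∷ ys) = (if x then y else not y) ∧ (xs ==ˢ ys)

_⇒ᵇ_ : Bool → Bool → Bool
a ⇒ᵇ b = not a ∨ b

-- A partition of Fin n is encoded by the vector p assigning to each
-- element x the block  lookup p x  of the partition containing x.
-- Every partition has exactly one such encoding, and the valid
-- encodings are exactly the vectors with
--   x ∈ p[x]   and   y ∈ p[x] ⇒ p[y] = p[x];
-- the blocks of the partition are then the subsets p[x].

Part : ℕ → Set
Part n = Vec (Subset n) n

IsPartition : ∀ {n} → Part n → Bool
IsPartition {n} p =
  all (λ x → lookup (lookup p x) x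
           ∧ all (λ y → lookup (lookup p x) y ⇒ᵇ (lookup p y ==ˢ lookup p x))
                 (allFin n))
      (allFin n)

partitions : (n : ℕ) → List (Part n)
partitions n = filterᵇ IsPartition (allVecs (allSubsets n) n)

IsSingleton : ∀ {n} → Part n → Fin n → Bool
IsSingleton p x = lookup p x ==ˢ ⁅ x ⁆

-- The largest singleton of p (elements of Fin (n) numbered 0..n-1,
-- i.e. element x of Fin n stands for toℕ x + 1 in {1,…,n}) is the
-- element with index k.
LargestSingletonIs : ∀ {n} → Part n → ℕ → Bool
LargestSingletonIs {n} p k =
  any (λ x → (toℕ x ≡ᵇ k) ∧ IsSingleton p x) (allFin n)
  ∧ all (λ x → (k <ᵇ toℕ x) ⇒ᵇ not (IsSingleton p x)) (allFin n)

Bell : ℕ → ℕ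
Bell n = length (partitions n)

-- A n k: number of partitions of {1,…,n+1} whose largest singleton is k+1
-- (index k in Fin (n+1)).
A : ℕ → ℕ → ℕ
A n k = countᵇ (λ p → LargestSingletonIs p k) (partitions (suc n))

_==ᶠ_ : ∀ {n} → Fin n → Fin n → Bool
x ==ᶠ y = toℕ x ≡ᵇ toℕ y

IsPermutation : ∀ {n} → Vec (Fin n) n → Bool
IsPermutation {n} f =
  all (λ x → all (λ y → (lookup f x ==ᶠ lookup f y) ⇒ᵇ (x ==ᶠ y)) (allFin n)) (allFin n)
  ∧ all (λ z → any (λ x → lookup f x ==ᶠ z) (allFin n)) (allFin n)

FixedPointFree : ∀ {n} → Vec (Fin n) n → Bool
FixedPointFree {n} f = all (λ x → not (lookup f x ==ᶠ x)) (allFin n)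

D : ℕ → ℕ
D n = countᵇ (λ f → IsPermutation f ∧ FixedPointFree f) (allVecs (allFin n) n)

sumTo : ℕ → (ℕ → ℕ) → ℕ
sumTo n f = foldr (λ j s → f j Data.Nat.+ s) 0 (upTo (suc n))

sumToℤ : ℕ → (ℕ → ℤ) → ℤ
sumToℤ n f = foldr (λ j s → f j +ℤ s) (⁺ 0) (upTo (suc n))

-- Number the elements of an n-set 0,…,n−1 and let U(n, k) count its partitions with no
-- singleton block {y} for y ≥ k. Deleting a singleton block {x} (and renumbering the
-- elements above x) is a bijection from the partitions of an (n+1)-set having {x} as a
-- block onto the partitions of an n-set. Hence A(n, k) = U(n, k); splitting according to
-- whether {k} is a block gives Pascal's recurrence U(n+1, k+1) = U(n+1, k) + U(n, k); and
-- U(n, n) = Bell n. Deleting fixed points instead gives the same recurrence for the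
-- permutations with no fixed point ≥ k, which count D n for k = 0 and n! for k = n. For any
-- array with this recurrence the binomial transform of a column is the diagonal, so
-- Bell (k + N) = Σ_j C(N, j) A(k + j, k) and N! = Σ_j C(N, j) D j.
--
-- With ⋆ the binomial convolution, the first identity is A_k ⋆ (1 ⋆ D) = (A_k ⋆ 1) ⋆ D
-- = Bell_k ⋆ D. For the second, both sides S(n, k, i) satisfy S(n+1, k, i) =
-- S(n, k+1, i+1) − S(n, k, i+1) − S(n, k, i), by the Leibniz rule for ⋆ and Pascal's
-- recurrence for A, and they agree at n = 0 since A(k, k) = Bell k.

module Submission where

open import Defs
open import Data.Bool using (Bool; true; false; T; not; _∧_)
open import Data.Bool.Properties using (T-∧; T-≡)
open import Data.Bool.ListAction using (all; any)
open import Data.Nat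
  using (ℕ; zero; suc; _+_; _*_; _∸_; _!; _≤_; _<_; _≤ᵇ_; _<ᵇ_; _≡ᵇ_; z≤n; s≤s; s≤s⁻¹)
import Data.Nat.Properties as ℕ
open import Data.Nat.Combinatorics using (_C_; nCk+nC[k+1]≡[n+1]C[k+1])
open import Data.Integer using (ℤ; +_; -_)
  renaming (_+_ to _+ℤ_; _-_ to _-ℤ_; _*_ to _*ℤ_; _^_ to _^ℤ_)
import Data.Integer.Properties as ℤ
open import Data.Integer.Tactic.RingSolver using (solve-∀)
open import Data.Fin using (Fin; toℕ; fromℕ<; punchIn; punchOut; _≟_) renaming (zero to fzero; suc to fsuc)
import Data.Fin.Properties as Fin
open import Data.Fin.Subset using (Subset; ⁅_⁆; ⊥)
import Data.Fin.Subset.Properties as Subset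
open import Data.Vec using (Vec; []; _∷_; lookup; tabulate; insertAt; removeAt)
import Data.Vec as Vec
import Data.Vec.Properties as Vec
open import Data.List
  using (List; []; _∷_; _++_; map; concatMap; length; filterᵇ; allFin; cartesianProductWith; foldr; applyUpTo; upTo)
import Data.List.Properties as List
open import Data.List.Membership.Propositional using (_∈_; lose)
open import Data.List.Membership.Propositional.Properties
  using (∈-allFin; ∈-map⁺; ∈-map⁻; ∈-filter⁺; ∈-filter⁻; ∈-cartesianProductWith⁺)
open import Data.List.Membership.Propositional.Properties.WithK using (unique∧set⇒bag)
open import Data.List.Relation.Unary.Any using (here; there; satisfied)
import Data.List.Relation.Unary.All as All
open import Data.List.Relation.Unary.All.Properties using (all⁺; all⁻)
open import Data.List.Relation.Unary.Any.Properties using (any⁺; any⁻)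
open import Data.List.Relation.Unary.AllPairs using ([]; _∷_)
open import Data.List.Relation.Unary.Unique.Propositional using (Unique)
import Data.List.Relation.Unary.Unique.Propositional.Properties as Unique
open import Data.List.Relation.Binary.BagAndSetEquality using (∼bag⇒↭)
open import Data.List.Relation.Binary.Permutation.Propositional.Properties using (↭-length)
open import Data.Product using (∃; _×_; _,_; proj₁; proj₂; uncurry)
open import Data.Sum using (inj₁; inj₂)
open import Data.Empty using (⊥-elim)
open import Function using (_∘_; _⇔_; mk⇔; Equivalence)
open import Relation.Nullary using (¬_; yes; no; contradiction)
open import Relation.Nullary.Decidable using (T?)
open import Relation.Binary.PropositionalEquality
  using (_≡_; _≢_; refl; sym; trans; cong; cong₂; subst; module ≡-Reasoning)

⇔⇒≡ : ∀ {a b} → T a ⇔ T b → a ≡ b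
⇔⇒≡ {false} {false} _ = refl
⇔⇒≡ {false} {true}  h = ⊥-elim (Equivalence.from h _)
⇔⇒≡ {true}  {false} h = ⊥-elim (Equivalence.to h _)
⇔⇒≡ {true}  {true}  _ = refl

T-⇒ᵇ : ∀ {a b} → T (a ⇒ᵇ b) ⇔ (T a → T b)
T-⇒ᵇ {false} = mk⇔ (λ _ ()) (λ _ → _)
T-⇒ᵇ {true}  = mk⇔ (λ h _ → h) (λ f → f _)

T-not : ∀ {a} → T (not a) ⇔ (¬ T a)
T-not {false} = mk⇔ (λ _ ()) (λ _ → _)
T-not {true}  = mk⇔ (λ ()) (λ f → f _)

T-all-allFin : ∀ {n} (p : Fin n → Bool) → T (all p (allFin n)) ⇔ (∀ x → T (p x))
T-all-allFin p = mk⇔ (λ h x → All.lookup (all⁺ p _ h) (∈-allFin x))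
                     (λ h → all⁻ p {allFin _} (All.tabulate (λ {x} _ → h x)))

T-any-allFin : ∀ {n} (p : Fin n → Bool) → T (any p (allFin n)) ⇔ ∃ (T ∘ p)
T-any-allFin p = mk⇔ (λ h → satisfied (any⁻ p (allFin _) h))
                     (λ (x , px) → any⁺ {xs = allFin _} p (lose (∈-allFin x) px))

T-==ˢ : ∀ {n} {s t : Subset n} → T (s ==ˢ t) ⇔ s ≡ t
T-==ˢ {s = s} = mk⇔ to (λ { refl → refl-==ˢ s })
  where
  to : ∀ {n} {s t : Subset n} → T (s ==ˢ t) → s ≡ t
  to {s = []}        {[]}        _ = refl
  to {s = true ∷ s}  {true ∷ t}  h = cong (true ∷_) (to h)
  to {s = false ∷ s} {false ∷ t} h = cong (false ∷_) (to h)
  refl-==ˢ : ∀ {n} (s : Subset n) → T (s ==ˢ s)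
  refl-==ˢ []          = _
  refl-==ˢ (true ∷ s)  = refl-==ˢ s
  refl-==ˢ (false ∷ s) = refl-==ˢ s

T-==ᶠ : ∀ {n} {x y : Fin n} → T (x ==ᶠ y) ⇔ x ≡ y
T-==ᶠ {x = x} {y} = mk⇔ (Fin.toℕ-injective ∘ ℕ.≡ᵇ⇒≡ (toℕ x) (toℕ y))
                        (ℕ.≡⇒≡ᵇ (toℕ x) (toℕ y) ∘ cong toℕ)

T-lookup-⁅⁆ : ∀ {n} (x y : Fin n) → T (lookup ⁅ x ⁆ y) ⇔ y ≡ x
T-lookup-⁅⁆ x y = mk⇔ (λ h → Subset.x∈⁅y⁆⇒x≡y x (Vec.lookup⇒[]= y ⁅ x ⁆ (Equivalence.to T-≡ h)))
                     (λ { refl → Equivalence.from T-≡ (Vec.[]=⇒lookup (Subset.x∈⁅x⁆ y)) })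

module _ {A : Set} where

  countᵇ-cong : ∀ {p q : A → Bool} xs → (∀ {x} → x ∈ xs → p x ≡ q x) →
                countᵇ p xs ≡ countᵇ q xs
  countᵇ-cong []       _ = refl
  countᵇ-cong {p} {q} (x ∷ xs) eq with p x | q x | eq (here refl)
  ... | true  | true  | _ = cong suc (countᵇ-cong xs (eq ∘ there))
  ... | false | false | _ = countᵇ-cong xs (eq ∘ there)

  countᵇ-split : ∀ (s p : A → Bool) xs →
    countᵇ p xs ≡ countᵇ (λ x → s x ∧ p x) xs + countᵇ (λ x → not (s x) ∧ p x) xs
  countᵇ-split s p []       = refl
  countᵇ-split s p (x ∷ xs) with s x | p x
  ... | true  | true  = cong suc (countᵇ-split s p xs)
  ... | true  | false = countᵇ-split s p xs
  ... | false | true  = trans (cong suc (countᵇ-split s p xs)) (sym (ℕ.+-suc _ _))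
  ... | false | false = countᵇ-split s p xs

  countᵇ-filterᵇ : ∀ (p q : A → Bool) xs →
    countᵇ q (filterᵇ p xs) ≡ countᵇ (λ x → p x ∧ q x) xs
  countᵇ-filterᵇ p q []       = refl
  countᵇ-filterᵇ p q (x ∷ xs) with p x
  ... | false = countᵇ-filterᵇ p q xs
  ... | true with q x
  ...   | true  = cong suc (countᵇ-filterᵇ p q xs)
  ...   | false = countᵇ-filterᵇ p q xs

  countᵇ-true : ∀ (p : A → Bool) xs → (∀ x → T (p x)) → countᵇ p xs ≡ length xs
  countᵇ-true p []       _  = refl
  countᵇ-true p (x ∷ xs) px with p x | px x
  ... | true | _ = cong suc (countᵇ-true p xs px)

  countᵇ-++ : ∀ (p : A → Bool) xs ys → countᵇ p (xs ++ ys) ≡ countᵇ p xs + countᵇ p ys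
  countᵇ-++ p []       ys = refl
  countᵇ-++ p (x ∷ xs) ys with p x
  ... | true  = cong suc (countᵇ-++ p xs ys)
  ... | false = countᵇ-++ p xs ys

module _ {A B : Set} where

  countᵇ-map : ∀ (p : B → Bool) (f : A → B) xs → countᵇ p (map f xs) ≡ countᵇ (p ∘ f) xs
  countᵇ-map p f []       = refl
  countᵇ-map p f (x ∷ xs) with p (f x)
  ... | true  = cong suc (countᵇ-map p f xs)
  ... | false = countᵇ-map p f xs

  countᵇ-bijection : ∀ {xs : List A} {ys : List B} {p : A → Bool} {q : B → Bool}
    (f : A → B) (g : B → A) → Unique xs → Unique ys →
    (∀ {x} → x ∈ xs → T (p x) → f x ∈ ys × T (q (f x))) →
    (∀ {y} → y ∈ ys → T (q y) → g y ∈ xs × T (p (g y))) →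
    (∀ {x} → x ∈ xs → T (p x) → g (f x) ≡ x) →
    (∀ {y} → y ∈ ys → T (q y) → f (g y) ≡ y) →
    countᵇ p xs ≡ countᵇ q ys
  countᵇ-bijection {xs} {ys} {p} {q} f g !xs !ys f∈ g∈ gf fg = begin
    length (filterᵇ p xs)          ≡⟨ List.length-map f (filterᵇ p xs) ⟨
    length (map f (filterᵇ p xs))  ≡⟨ ↭-length (∼bag⇒↭ (unique∧set⇒bag !image !ys′ (mk⇔ to from))) ⟩
    length (filterᵇ q ys)          ∎
    where
    open ≡-Reasoning
    !ys′ = Unique.filter⁺ (T? ∘ q) !ys
    !image : Unique (map f (filterᵇ p xs))
    !image = Unique.map⁻ {f = g} (subst Unique (sym g∘f≡id) (Unique.filter⁺ (T? ∘ p) !xs))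
      where
      g∘f≡id : map g (map f (filterᵇ p xs)) ≡ filterᵇ p xs
      g∘f≡id = trans (sym (List.map-∘ (filterᵇ p xs))) (List.map-id-local (All.tabulate
                 (λ x∈ → let x∈xs , px = ∈-filter⁻ (T? ∘ p) x∈ in gf x∈xs px)))
    to : ∀ {z} → z ∈ map f (filterᵇ p xs) → z ∈ filterᵇ q ys
    to z∈ with ∈-map⁻ f z∈
    ... | x , x∈ , refl with ∈-filter⁻ (T? ∘ p) x∈
    ...   | x∈xs , px = uncurry (∈-filter⁺ (T? ∘ q)) (f∈ x∈xs px)
    from : ∀ {z} → z ∈ filterᵇ q ys → z ∈ map f (filterᵇ p xs)
    from z∈ with ∈-filter⁻ (T? ∘ q) z∈
    ... | y∈ys , qy = subst (_∈ map f (filterᵇ p xs)) (fg y∈ys qy)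
                        (∈-map⁺ f (uncurry (∈-filter⁺ (T? ∘ p)) (g∈ y∈ys qy)))

module _ {A : Set} where

  allVecs-suc : ∀ (xs : List A) m →
    allVecs xs (suc m) ≡ cartesianProductWith _∷_ xs (allVecs xs m)
  allVecs-suc xs m = prepend xs
    where
    prepend : ∀ ys → concatMap (λ y → map (y ∷_) (allVecs xs m)) ys ≡ cartesianProductWith _∷_ ys (allVecs xs m)
    prepend []       = refl
    prepend (y ∷ ys) = cong (map (y ∷_) (allVecs xs m) ++_) (prepend ys)

  allVecs-unique : ∀ {xs : List A} m → Unique xs → Unique (allVecs xs m)
  allVecs-unique zero    _   = All.[] ∷ []
  allVecs-unique {xs} (suc m) !xs = subst Unique (sym (allVecs-suc xs m))
    (Unique.cartesianProductWith⁺ _∷_ Vec.∷-injective !xs (allVecs-unique m !xs))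

  ∈-allVecs : ∀ {xs : List A} → (∀ x → x ∈ xs) → ∀ {m} (v : Vec A m) → v ∈ allVecs xs m
  ∈-allVecs ∈xs []           = here refl
  ∈-allVecs {xs} ∈xs {suc m} (x ∷ v) = subst ((x ∷ v) ∈_) (sym (allVecs-suc xs m))
    (∈-cartesianProductWith⁺ _∷_ (∈xs x) (∈-allVecs ∈xs v))

NoneFrom : ∀ {n} → ℕ → (Fin n → Bool) → Bool
NoneFrom k Z = all (λ y → (k ≤ᵇ toℕ y) ⇒ᵇ not (Z y)) (allFin _)

NoneFrom-avoids : ∀ {n} k (Z : Fin n → Bool) → T (NoneFrom k Z) → ∀ y → k ≤ toℕ y → ¬ T (Z y)
NoneFrom-avoids k Z h y k≤y =
  Equivalence.to T-not (Equivalence.to T-⇒ᵇ (Equivalence.to (T-all-allFin _) h y) (ℕ.≤⇒≤ᵇ k≤y))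

NoneFrom-intro : ∀ {n} k (Z : Fin n → Bool) → (∀ y → k ≤ toℕ y → ¬ T (Z y)) → T (NoneFrom k Z)
NoneFrom-intro k Z h = Equivalence.from (T-all-allFin _) (λ y → Equivalence.from T-⇒ᵇ
  (λ k≤y → Equivalence.from T-not (h y (ℕ.≤ᵇ⇒≤ k (toℕ y) k≤y))))

NoneFrom-vacuous : ∀ {n} (Z : Fin n → Bool) → T (NoneFrom n Z)
NoneFrom-vacuous Z = NoneFrom-intro _ Z (λ y n≤y → contradiction n≤y (ℕ.<⇒≱ (Fin.toℕ<n y)))

NoneFrom-suc : ∀ {n} (Z : Fin n → Bool) {x} {k} → toℕ x ≡ k →
  not (Z x) ∧ NoneFrom (suc k) Z ≡ NoneFrom k Z
NoneFrom-suc Z {x} {k} refl = ⇔⇒≡ (mk⇔ to from)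
  where
  to : T (not (Z x) ∧ NoneFrom (suc k) Z) → T (NoneFrom k Z)
  to h = NoneFrom-intro k Z avoid
    where
    h′ = Equivalence.to T-∧ h
    avoid : ∀ y → toℕ x ≤ toℕ y → ¬ T (Z y)
    avoid y x≤y with ℕ.m≤n⇒m<n∨m≡n x≤y
    ... | inj₁ x<y = NoneFrom-avoids (suc k) Z (proj₂ h′) y x<y
    ... | inj₂ x≡y = subst (¬_ ∘ T ∘ Z) (Fin.toℕ-injective x≡y) (Equivalence.to T-not (proj₁ h′))
  from : T (NoneFrom k Z) → T (not (Z x) ∧ NoneFrom (suc k) Z)
  from h = Equivalence.from T-∧ (Equivalence.from T-not (NoneFrom-avoids k Z h x ℕ.≤-refl) ,
                                 NoneFrom-intro (suc k) Z (λ y k<y → NoneFrom-avoids k Z h y (ℕ.<⇒≤ k<y)))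

data PunchInView {n} (x : Fin (suc n)) : Fin (suc n) → Set where
  at      : PunchInView x x
  punched : ∀ y → PunchInView x (punchIn x y)

punchInView : ∀ {n} (x b : Fin (suc n)) → PunchInView x b
punchInView x b with x ≟ b
... | yes refl = at
... | no x≢b   = subst (PunchInView x) (Fin.punchIn-punchOut x≢b) (punched (punchOut x≢b))

≤⇔<punchIn : ∀ {n} (x : Fin (suc n)) (y : Fin n) → toℕ x ≤ toℕ y ⇔ toℕ x < toℕ (punchIn x y)
≤⇔<punchIn fzero    y        = mk⇔ (λ _ → s≤s z≤n) (λ _ → z≤n)
≤⇔<punchIn (fsuc x) fzero    = mk⇔ (λ ()) (λ ())
≤⇔<punchIn (fsuc x) (fsuc y) = mk⇔ (s≤s ∘ to ∘ s≤s⁻¹) (s≤s ∘ from ∘ s≤s⁻¹)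
  where open Equivalence (≤⇔<punchIn x y)

NoneFrom-punchIn : ∀ {n} (Z : Fin (suc n) → Bool) (Z′ : Fin n → Bool) {x} {k} → toℕ x ≡ k →
  (∀ y → Z′ y ≡ Z (punchIn x y)) → NoneFrom (suc k) Z ≡ NoneFrom k Z′
NoneFrom-punchIn Z Z′ {x} refl Z′≗Z∘punchIn = ⇔⇒≡ (mk⇔ to from)
  where
  to : T (NoneFrom (suc (toℕ x)) Z) → T (NoneFrom (toℕ x) Z′)
  to h = NoneFrom-intro _ Z′ λ y x≤y →
    subst (¬_ ∘ T) (sym (Z′≗Z∘punchIn y))
      (NoneFrom-avoids _ Z h (punchIn x y) (Equivalence.to (≤⇔<punchIn x y) x≤y))
  from : T (NoneFrom (toℕ x) Z′) → T (NoneFrom (suc (toℕ x)) Z)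
  from h = NoneFrom-intro _ Z avoid
    where
    avoid : ∀ b → toℕ x < toℕ b → ¬ T (Z b)
    avoid b x<b with punchInView x b
    ... | at        = contradiction x<b (ℕ.<-irrefl refl)
    ... | punched y = subst (¬_ ∘ T) (Z′≗Z∘punchIn y)
                        (NoneFrom-avoids _ Z′ h y (Equivalence.from (≤⇔<punchIn x y) x<b))

any-at : ∀ {n} (Z : Fin n → Bool) {x} {k} → toℕ x ≡ k →
  any (λ y → (toℕ y ≡ᵇ k) ∧ Z y) (allFin n) ≡ Z x
any-at Z {x} {k} refl = ⇔⇒≡ (mk⇔ to from)
  where
  to : T (any (λ y → (toℕ y ≡ᵇ toℕ x) ∧ Z y) (allFin _)) → T (Z x)
  to h with Equivalence.to (T-any-allFin _) h
  ... | y , y=x∧Zy with Equivalence.to T-∧ y=x∧Zy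
  ...   | y=x , Zy = subst (T ∘ Z) (Fin.toℕ-injective (ℕ.≡ᵇ⇒≡ (toℕ y) (toℕ x) y=x)) Zy
  from : T (Z x) → T (any (λ y → (toℕ y ≡ᵇ toℕ x) ∧ Z y) (allFin _))
  from Zx = Equivalence.from (T-any-allFin _) (x , Equivalence.from T-∧ (ℕ.≡⇒≡ᵇ (toℕ x) (toℕ x) refl , Zx))

-- Deleting marked points

-- Instances: set partitions with their singleton blocks, permutations with their fixed points.
record PointDeletion : Set₁ where
  field
    Structure          : ℕ → Set
    structures         : ∀ n → List (Structure n)
    structures-unique  : ∀ n → Unique (structures n)
    Marked             : ∀ {n} → Structure n → Fin n → Bool
    delete             : ∀ {n} → Fin (suc n) → Structure (suc n) → Structure n
    adjoin             : ∀ {n} → Fin (suc n) → Structure n → Structure (suc n)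
    delete-∈           : ∀ {n} x {σ : Structure (suc n)} → σ ∈ structures (suc n) →
                         T (Marked σ x) → delete x σ ∈ structures n
    adjoin-∈           : ∀ {n} x {τ : Structure n} → τ ∈ structures n → adjoin x τ ∈ structures (suc n)
    adjoin-delete      : ∀ {n} x {σ : Structure (suc n)} → σ ∈ structures (suc n) →
                         T (Marked σ x) → adjoin x (delete x σ) ≡ σ
    delete-adjoin      : ∀ {n} x (τ : Structure n) → delete x (adjoin x τ) ≡ τ
    Marked-adjoin      : ∀ {n} x (τ : Structure n) → T (Marked (adjoin x τ) x)
    Marked-adjoin-punchIn : ∀ {n} x (τ : Structure n) y → Marked (adjoin x τ) (punchIn x y) ≡ Marked τ y

PascalRecurrence : (ℕ → ℕ → ℕ) → Set
PascalRecurrence f = ∀ {n k} → k ≤ n → f (suc n) (suc k) ≡ f (suc n) k + f n k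

module Unmarked (S : PointDeletion) where

  open PointDeletion S

  unmarkedFrom : ℕ → ℕ → ℕ
  unmarkedFrom n k = countᵇ (λ σ → NoneFrom k (Marked σ)) (structures n)

  count-Marked∧delete : ∀ {n} x (q : Structure n → Bool) →
    countᵇ (λ σ → Marked σ x ∧ q (delete x σ)) (structures (suc n)) ≡ countᵇ q (structures n)
  count-Marked∧delete {n} x q = countᵇ-bijection (delete x) (adjoin x)
    (structures-unique _) (structures-unique _) delete-∈′ adjoin-∈′
    (λ σ∈ h → adjoin-delete x σ∈ (proj₁ (Equivalence.to T-∧ h))) (λ _ _ → delete-adjoin x _)
    where
    delete-∈′ : ∀ {σ} → σ ∈ structures (suc n) → T (Marked σ x ∧ q (delete x σ)) →
                delete x σ ∈ structures n × T (q (delete x σ))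
    delete-∈′ σ∈ h = let Mσx , qσ = Equivalence.to T-∧ h in delete-∈ x σ∈ Mσx , qσ
    adjoin-∈′ : ∀ {τ} → τ ∈ structures n → T (q τ) →
                adjoin x τ ∈ structures (suc n) × T (Marked (adjoin x τ) x ∧ q (delete x (adjoin x τ)))
    adjoin-∈′ {τ} τ∈ qτ = adjoin-∈ x τ∈ ,
      Equivalence.from T-∧ (Marked-adjoin x τ , subst (T ∘ q) (sym (delete-adjoin x τ)) qτ)

  Marked-delete : ∀ {n} x {σ : Structure (suc n)} → σ ∈ structures (suc n) → T (Marked σ x) →
                  ∀ y → Marked (delete x σ) y ≡ Marked σ (punchIn x y)
  Marked-delete x σ∈ Mσx y = trans (sym (Marked-adjoin-punchIn x _ y))
                                   (cong (λ σ → Marked σ (punchIn x y)) (adjoin-delete x σ∈ Mσx))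

  count-Marked-at : ∀ {n} x {k} → toℕ x ≡ k →
    countᵇ (λ σ → Marked σ x ∧ NoneFrom (suc k) (Marked σ)) (structures (suc n)) ≡ unmarkedFrom n k
  count-Marked-at x {k} x=k = trans (countᵇ-cong _ through-delete)
                                    (count-Marked∧delete x (λ τ → NoneFrom k (Marked τ)))
    where
    through-delete : ∀ {σ} → σ ∈ structures _ →
      Marked σ x ∧ NoneFrom (suc k) (Marked σ) ≡ Marked σ x ∧ NoneFrom k (Marked (delete x σ))
    through-delete {σ} σ∈ with Marked σ x in Mσx
    ... | false = refl
    ... | true  = NoneFrom-punchIn (Marked σ) _ x=k
                    (Marked-delete x σ∈ (Equivalence.from T-≡ Mσx))

  unmarkedFrom-pascal : PascalRecurrence unmarkedFrom
  unmarkedFrom-pascal {n} {k} k≤n = begin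
    unmarkedFrom (suc n) (suc k)
      ≡⟨ countᵇ-split (λ σ → Marked σ x) (λ σ → NoneFrom (suc k) (Marked σ)) (structures (suc n)) ⟩
    countᵇ (λ σ → Marked σ x ∧ NoneFrom (suc k) (Marked σ)) (structures (suc n)) +
    countᵇ (λ σ → not (Marked σ x) ∧ NoneFrom (suc k) (Marked σ)) (structures (suc n))
      ≡⟨ cong₂ _+_ (count-Marked-at x x=k)
                   (countᵇ-cong (structures (suc n)) (λ {σ} _ → NoneFrom-suc (Marked σ) x=k)) ⟩
    unmarkedFrom n k + unmarkedFrom (suc n) k
      ≡⟨ ℕ.+-comm (unmarkedFrom n k) _ ⟩
    unmarkedFrom (suc n) k + unmarkedFrom n k ∎
    where
    open ≡-Reasoning
    x : Fin (suc n)
    x = fromℕ< (s≤s k≤n)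
    x=k : toℕ x ≡ k
    x=k = Fin.toℕ-fromℕ< (s≤s k≤n)

  unmarkedFrom-diagonal : ∀ n → unmarkedFrom n n ≡ length (structures n)
  unmarkedFrom-diagonal n = countᵇ-true _ (structures n) (NoneFrom-vacuous ∘ Marked)

lookup-ext : ∀ {A : Set} {n} {u v : Vec A n} → (∀ i → lookup u i ≡ lookup v i) → u ≡ v
lookup-ext {u = u} {v} eq =
  trans (sym (Vec.tabulate∘lookup u)) (trans (Vec.tabulate-cong eq) (Vec.tabulate∘lookup v))

lookup-removeAt : ∀ {A : Set} {n} (v : Vec A (suc n)) x y → lookup (removeAt v x) y ≡ lookup v (punchIn x y)
lookup-removeAt v x y = trans (cong (lookup (removeAt v x)) (sym (Fin.punchOut-punchIn x)))
                              (Vec.removeAt-punchOut v (Fin.punchInᵢ≢i x y ∘ sym))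

insertAt-⊥ : ∀ {n} (x : Fin (suc n)) → insertAt ⊥ x false ≡ ⊥
insertAt-⊥ fzero = refl
insertAt-⊥ {suc n} (fsuc x) = cong (false ∷_) (insertAt-⊥ x)

⁅punchIn⁆ : ∀ {n} (x : Fin (suc n)) y → ⁅ punchIn x y ⁆ ≡ insertAt ⁅ y ⁆ x false
⁅punchIn⁆ fzero    y        = refl
⁅punchIn⁆ (fsuc x) fzero    = cong (true ∷_) (sym (insertAt-⊥ x))
⁅punchIn⁆ (fsuc x) (fsuc y) = cong (false ∷_) (⁅punchIn⁆ x y)

insertAt-==ˢ : ∀ {n} (s t : Subset n) x b → (insertAt s x b ==ˢ insertAt t x b) ≡ (s ==ˢ t)
insertAt-==ˢ s       t       fzero    true  = refl
insertAt-==ˢ s       t       fzero    false = refl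
insertAt-==ˢ (a ∷ s) (c ∷ t) (fsuc x) b     = cong (_ ∧_) (insertAt-==ˢ s t x b)

-- Set partitions

record ValidPartition {n} (p : Part n) : Set where
  field
    own-block    : ∀ x → T (lookup (lookup p x) x)
    block-closed : ∀ x y → T (lookup (lookup p x) y) → lookup p y ≡ lookup p x

T-IsPartition : ∀ {n} (p : Part n) → T (IsPartition p) ⇔ ValidPartition p
T-IsPartition p = mk⇔ to from
  where
  to : T (IsPartition p) → ValidPartition p
  to h = record
    { own-block    = λ x → proj₁ (conjuncts x)
    ; block-closed = λ x y y∈ → Equivalence.to T-==ˢ
        (Equivalence.to T-⇒ᵇ (Equivalence.to (T-all-allFin _) (proj₂ (conjuncts x)) y) y∈)
    }
    where conjuncts = λ x → Equivalence.to T-∧ (Equivalence.to (T-all-allFin _) h x)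
  from : ValidPartition p → T (IsPartition p)
  from v = Equivalence.from (T-all-allFin _) λ x → Equivalence.from T-∧
    ( own-block x
    , Equivalence.from (T-all-allFin _) λ y → Equivalence.from T-⇒ᵇ λ y∈ →
        Equivalence.from T-==ˢ (block-closed x y y∈))
    where open ValidPartition v

∈-partitions : ∀ {n} {p : Part n} → p ∈ partitions n ⇔ ValidPartition p
∈-partitions {n} {p} = mk⇔
  (λ p∈ → Equivalence.to (T-IsPartition p)
             (proj₂ (∈-filter⁻ (T? ∘ IsPartition) {xs = allVecs (allSubsets n) n} p∈)))
  (λ v → ∈-filter⁺ (T? ∘ IsPartition) (∈-allVecs (∈-allVecs ∈-bools) p) (Equivalence.from (T-IsPartition p) v))
  where
  ∈-bools : ∀ b → b ∈ true ∷ false ∷ []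
  ∈-bools true  = here refl
  ∈-bools false = there (here refl)

partitions-unique : ∀ n → Unique (partitions n)
partitions-unique n =
  Unique.filter⁺ (T? ∘ IsPartition) (allVecs-unique n (allVecs-unique n (((λ ()) All.∷ All.[]) ∷ All.[] ∷ [])))

removeSingleton : ∀ {n} → Fin (suc n) → Part (suc n) → Part n
removeSingleton x p = tabulate (λ y → removeAt (lookup p (punchIn x y)) x)

insertSingleton : ∀ {n} → Fin (suc n) → Part n → Part (suc n)
insertSingleton x q = insertAt (Vec.map (λ s → insertAt s x false) q) x ⁅ x ⁆

lookup-removeSingleton : ∀ {n} x (p : Part (suc n)) y z →
  lookup (lookup (removeSingleton x p) y) z ≡ lookup (lookup p (punchIn x y)) (punchIn x z)
lookup-removeSingleton x p y z =
  trans (cong (λ s → lookup s z) (Vec.lookup∘tabulate _ y)) (lookup-removeAt (lookup p (punchIn x y)) x z)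

lookup-insertSingleton-at : ∀ {n} x (q : Part n) → lookup (insertSingleton x q) x ≡ ⁅ x ⁆
lookup-insertSingleton-at x q = Vec.insertAt-lookup _ x _

lookup-insertSingleton-punchIn : ∀ {n} x (q : Part n) y →
  lookup (insertSingleton x q) (punchIn x y) ≡ insertAt (lookup q y) x false
lookup-insertSingleton-punchIn x q y = trans (Vec.insertAt-punchIn _ x _ y) (Vec.lookup-map y _ q)

module _ {n} (x : Fin (suc n)) {p : Part (suc n)} (v : ValidPartition p) (p[x]≡⁅x⁆ : lookup p x ≡ ⁅ x ⁆) where

  open ValidPartition v

  singleton-not-in-other-blocks : ∀ y → lookup (lookup p (punchIn x y)) x ≡ false
  singleton-not-in-other-blocks y with lookup (lookup p (punchIn x y)) x in x∈
  ... | false = refl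
  ... | true  = contradiction (Equivalence.to (T-lookup-⁅⁆ x (punchIn x y)) own-block′) (Fin.punchInᵢ≢i x y)
    where
    own-block′ : T (lookup ⁅ x ⁆ (punchIn x y))
    own-block′ = subst (λ s → T (lookup s (punchIn x y)))
      (trans (sym (block-closed (punchIn x y) x (Equivalence.from T-≡ x∈))) p[x]≡⁅x⁆) (own-block (punchIn x y))

  removeSingleton-valid : ValidPartition (removeSingleton x p)
  removeSingleton-valid = record
    { own-block    = λ y → subst T (sym (lookup-removeSingleton x p y y)) (own-block (punchIn x y))
    ; block-closed = λ y z z∈ → lookup-ext λ w → begin
        lookup (lookup (removeSingleton x p) z) w   ≡⟨ lookup-removeSingleton x p z w ⟩
        lookup (lookup p (punchIn x z)) (punchIn x w)
          ≡⟨ cong (λ s → lookup s (punchIn x w))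
               (block-closed (punchIn x y) (punchIn x z) (subst T (lookup-removeSingleton x p y z) z∈)) ⟩
        lookup (lookup p (punchIn x y)) (punchIn x w) ≡⟨ lookup-removeSingleton x p y w ⟨
        lookup (lookup (removeSingleton x p) y) w   ∎
    }
    where open ≡-Reasoning

  insertSingleton-removeSingleton : insertSingleton x (removeSingleton x p) ≡ p
  insertSingleton-removeSingleton = lookup-ext λ b → agree b (punchInView x b)
    where
    agree : ∀ b → PunchInView x b → lookup (insertSingleton x (removeSingleton x p)) b ≡ lookup p b
    agree _ at          = trans (lookup-insertSingleton-at x _) (sym p[x]≡⁅x⁆)
    agree _ (punched y) = begin
      lookup (insertSingleton x (removeSingleton x p)) (punchIn x y)
        ≡⟨ lookup-insertSingleton-punchIn x _ y ⟩
      insertAt (lookup (removeSingleton x p) y) x false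
        ≡⟨ cong (λ s → insertAt s x false) (Vec.lookup∘tabulate _ y) ⟩
      insertAt (removeAt (lookup p (punchIn x y)) x) x false
        ≡⟨ cong (insertAt _ x) (singleton-not-in-other-blocks y) ⟨
      insertAt (removeAt (lookup p (punchIn x y)) x) x (lookup (lookup p (punchIn x y)) x)
        ≡⟨ Vec.insertAt-removeAt _ x ⟩
      lookup p (punchIn x y) ∎
      where open ≡-Reasoning

insertSingleton-valid : ∀ {n} x {q : Part n} → ValidPartition q → ValidPartition (insertSingleton x q)
insertSingleton-valid x {q} v = record
  { own-block    = λ b → own-block′ b (punchInView x b)
  ; block-closed = λ a b → block-closed′ a b (punchInView x a) (punchInView x b)
  }
  where
  open ValidPartition v
  q′ = insertSingleton x q
  own-block′ : ∀ b → PunchInView x b → T (lookup (lookup q′ b) b)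
  own-block′ _ at = subst (λ s → T (lookup s x)) (sym (lookup-insertSingleton-at x q))
                          (Equivalence.from (T-lookup-⁅⁆ x x) refl)
  own-block′ _ (punched y) = subst (λ s → T (lookup s (punchIn x y))) (sym (lookup-insertSingleton-punchIn x q y))
                                   (subst T (sym (Vec.insertAt-punchIn _ x false y)) (own-block y))
  block-closed′ : ∀ a b → PunchInView x a → PunchInView x b →
                  T (lookup (lookup q′ a) b) → lookup q′ b ≡ lookup q′ a
  block-closed′ _ b at _ b∈ = cong (lookup q′)
    (Equivalence.to (T-lookup-⁅⁆ x b) (subst (λ s → T (lookup s b)) (lookup-insertSingleton-at x q) b∈))
  block-closed′ _ _ (punched y) at x∈ = contradiction
    (subst (λ s → T (lookup s x)) (lookup-insertSingleton-punchIn x q y) x∈)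
    (subst (¬_ ∘ T) (sym (Vec.insertAt-lookup (lookup q y) x false)) (λ ()))
  block-closed′ _ _ (punched y) (punched z) z∈ = begin
    lookup q′ (punchIn x z)         ≡⟨ lookup-insertSingleton-punchIn x q z ⟩
    insertAt (lookup q z) x false   ≡⟨ cong (λ s → insertAt s x false) (block-closed y z z∈′) ⟩
    insertAt (lookup q y) x false   ≡⟨ lookup-insertSingleton-punchIn x q y ⟨
    lookup q′ (punchIn x y)         ∎
    where
    open ≡-Reasoning
    z∈′ : T (lookup (lookup q y) z)
    z∈′ = subst T (Vec.insertAt-punchIn (lookup q y) x false z)
            (subst (λ s → T (lookup s (punchIn x z))) (lookup-insertSingleton-punchIn x q y) z∈)

removeSingleton-insertSingleton : ∀ {n} x (q : Part n) → removeSingleton x (insertSingleton x q) ≡ q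
removeSingleton-insertSingleton x q = lookup-ext λ y → begin
  lookup (removeSingleton x (insertSingleton x q)) y            ≡⟨ Vec.lookup∘tabulate _ y ⟩
  removeAt (lookup (insertSingleton x q) (punchIn x y)) x
    ≡⟨ cong (λ s → removeAt s x) (lookup-insertSingleton-punchIn x q y) ⟩
  removeAt (insertAt (lookup q y) x false) x                    ≡⟨ Vec.removeAt-insertAt _ x false ⟩
  lookup q y                                                    ∎
  where open ≡-Reasoning

IsSingleton-insertSingleton-punchIn : ∀ {n} x (q : Part n) y →
  IsSingleton (insertSingleton x q) (punchIn x y) ≡ IsSingleton q y
IsSingleton-insertSingleton-punchIn x q y
  rewrite lookup-insertSingleton-punchIn x q y | ⁅punchIn⁆ x y = insertAt-==ˢ _ _ x false

singletonDeletion : PointDeletion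
singletonDeletion = record
  { Structure          = Part
  ; structures         = partitions
  ; structures-unique  = partitions-unique
  ; Marked             = IsSingleton
  ; delete             = removeSingleton
  ; adjoin             = insertSingleton
  ; delete-∈           = λ x p∈ x↦⁅x⁆ → Equivalence.from ∈-partitions
      (removeSingleton-valid x (Equivalence.to ∈-partitions p∈) (Equivalence.to T-==ˢ x↦⁅x⁆))
  ; adjoin-∈           = λ x q∈ → Equivalence.from ∈-partitions
      (insertSingleton-valid x (Equivalence.to ∈-partitions q∈))
  ; adjoin-delete      = λ x p∈ x↦⁅x⁆ →
      insertSingleton-removeSingleton x (Equivalence.to ∈-partitions p∈) (Equivalence.to T-==ˢ x↦⁅x⁆)
  ; delete-adjoin      = removeSingleton-insertSingleton
  ; Marked-adjoin      = λ x q → Equivalence.from T-==ˢ (lookup-insertSingleton-at x q)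
  ; Marked-adjoin-punchIn = IsSingleton-insertSingleton-punchIn
  }

module PartitionsWithoutSingletons = Unmarked singletonDeletion

A≡unmarkedFrom : ∀ {n k} → k ≤ n → A n k ≡ PartitionsWithoutSingletons.unmarkedFrom n k
A≡unmarkedFrom {n} {k} k≤n = trans
  (countᵇ-cong (partitions (suc n)) (λ {p} _ → cong (_∧ NoneFrom (suc k) (IsSingleton p)) (any-at (IsSingleton p) x=k)))
  (PartitionsWithoutSingletons.count-Marked-at x x=k)
  where
  x : Fin (suc n)
  x = fromℕ< (s≤s k≤n)
  x=k : toℕ x ≡ k
  x=k = Fin.toℕ-fromℕ< (s≤s k≤n)

A-pascal : PascalRecurrence A
A-pascal {n} {k} k≤n = begin
  A (suc n) (suc k)                       ≡⟨ A≡unmarkedFrom (s≤s k≤n) ⟩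
  unmarkedFrom (suc n) (suc k)            ≡⟨ unmarkedFrom-pascal k≤n ⟩
  unmarkedFrom (suc n) k + unmarkedFrom n k
    ≡⟨ cong₂ _+_ (A≡unmarkedFrom (ℕ.m≤n⇒m≤1+n k≤n)) (A≡unmarkedFrom k≤n) ⟨
  A (suc n) k + A n k                     ∎
  where
  open ≡-Reasoning
  open PartitionsWithoutSingletons

A-diagonal : ∀ n → A n n ≡ Bell n
A-diagonal n = trans (A≡unmarkedFrom {n} ℕ.≤-refl) (PartitionsWithoutSingletons.unmarkedFrom-diagonal n)

-- Permutations

Perm : ℕ → Set
Perm n = Vec (Fin n) n

permutations : ∀ n → List (Perm n)
permutations n = filterᵇ IsPermutation (allVecs (allFin n) n)

record ValidPermutation {n} (σ : Perm n) : Set where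
  field
    injective  : ∀ x y → lookup σ x ≡ lookup σ y → x ≡ y
    surjective : ∀ z → ∃ λ x → lookup σ x ≡ z

T-IsPermutation : ∀ {n} (σ : Perm n) → T (IsPermutation σ) ⇔ ValidPermutation σ
T-IsPermutation σ = mk⇔ to from
  where
  to : T (IsPermutation σ) → ValidPermutation σ
  to h = record
    { injective  = λ x y σx≡σy → Equivalence.to T-==ᶠ (Equivalence.to T-⇒ᵇ
        (Equivalence.to (T-all-allFin _) (Equivalence.to (T-all-allFin _) (proj₁ h′) x) y)
        (Equivalence.from T-==ᶠ σx≡σy))
    ; surjective = λ z → let x , σx≡z = Equivalence.to (T-any-allFin _)
                                          (Equivalence.to (T-all-allFin _) (proj₂ h′) z)
                         in x , Equivalence.to T-==ᶠ σx≡z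
    }
    where h′ = Equivalence.to T-∧ h
  from : ValidPermutation σ → T (IsPermutation σ)
  from v = Equivalence.from T-∧
    ( Equivalence.from (T-all-allFin _) (λ x → Equivalence.from (T-all-allFin _) λ y →
        Equivalence.from T-⇒ᵇ (Equivalence.from T-==ᶠ ∘ injective x y ∘ Equivalence.to T-==ᶠ))
    , Equivalence.from (T-all-allFin _) (λ z → let x , σx≡z = surjective z in
        Equivalence.from (T-any-allFin _) (x , Equivalence.from T-==ᶠ σx≡z)))
    where open ValidPermutation v

∈-permutations : ∀ {n} {σ : Perm n} → σ ∈ permutations n ⇔ ValidPermutation σ
∈-permutations {n} {σ} = mk⇔
  (λ σ∈ → Equivalence.to (T-IsPermutation σ)
             (proj₂ (∈-filter⁻ (T? ∘ IsPermutation) {xs = allVecs (allFin n) n} σ∈)))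
  (λ v → ∈-filter⁺ (T? ∘ IsPermutation) (∈-allVecs ∈-allFin σ) (Equivalence.from (T-IsPermutation σ) v))

permutations-unique : ∀ n → Unique (permutations n)
permutations-unique n = Unique.filter⁺ (T? ∘ IsPermutation) (allVecs-unique n (Unique.allFin⁺ n))

-- A total punchOut, returning the junk value d when i ≡ j.
punchOutOr : ∀ {n} → Fin n → Fin (suc n) → Fin (suc n) → Fin n
punchOutOr d i j with i ≟ j
... | yes _   = d
... | no i≢j  = punchOut i≢j

punchIn-punchOutOr : ∀ {n} (d : Fin n) {i j} → i ≢ j → punchIn i (punchOutOr d i j) ≡ j
punchIn-punchOutOr d {i} {j} i≢j with i ≟ j
... | yes i≡j  = contradiction i≡j i≢j
... | no i≢j′  = Fin.punchIn-punchOut i≢j′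

punchOutOr-punchIn : ∀ {n} (d : Fin n) i j → punchOutOr d i (punchIn i j) ≡ j
punchOutOr-punchIn d i j =
  Fin.punchIn-injective i _ _ (punchIn-punchOutOr d (Fin.punchInᵢ≢i i j ∘ sym))

-- Meant for σ with σ x = a: removes the pair x ↦ a.
removePair : ∀ {n} → Fin (suc n) → Fin (suc n) → Perm (suc n) → Perm n
removePair x a σ = tabulate (λ y → punchOutOr y a (lookup σ (punchIn x y)))

insertPair : ∀ {n} → Fin (suc n) → Fin (suc n) → Perm n → Perm (suc n)
insertPair x a τ = insertAt (Vec.map (punchIn a) τ) x a

lookup-insertPair-at : ∀ {n} x a (τ : Perm n) → lookup (insertPair x a τ) x ≡ a
lookup-insertPair-at x a τ = Vec.insertAt-lookup _ x a

lookup-insertPair-punchIn : ∀ {n} x a (τ : Perm n) y →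
  lookup (insertPair x a τ) (punchIn x y) ≡ punchIn a (lookup τ y)
lookup-insertPair-punchIn x a τ y = trans (Vec.insertAt-punchIn _ x a y) (Vec.lookup-map y _ τ)

module _ {n} (x a : Fin (suc n)) {σ : Perm (suc n)} (v : ValidPermutation σ) (σx≡a : lookup σ x ≡ a) where

  open ValidPermutation v

  punchIn-removePair : ∀ y → punchIn a (lookup (removePair x a σ) y) ≡ lookup σ (punchIn x y)
  punchIn-removePair y = trans (cong (punchIn a) (Vec.lookup∘tabulate _ y))
    (punchIn-punchOutOr y λ a≡σ[x+y] → Fin.punchInᵢ≢i x y (injective _ _ (trans (sym a≡σ[x+y]) (sym σx≡a))))

  removePair-valid : ValidPermutation (removePair x a σ)
  removePair-valid = record
    { injective  = λ y z eq → Fin.punchIn-injective x y z (injective _ _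
        (trans (sym (punchIn-removePair y)) (trans (cong (punchIn a) eq) (punchIn-removePair z))))
    ; surjective = λ w → preimage w (surjective (punchIn a w))
    }
    where
    preimage : ∀ w → ∃ (λ b → lookup σ b ≡ punchIn a w) → ∃ λ y → lookup (removePair x a σ) y ≡ w
    preimage w (b , σb≡a+w) with punchInView x b
    ... | at        = contradiction (trans (sym σb≡a+w) σx≡a) (Fin.punchInᵢ≢i a w)
    ... | punched y = y , Fin.punchIn-injective a _ _ (trans (punchIn-removePair y) σb≡a+w)

  insertPair-removePair : insertPair x a (removePair x a σ) ≡ σ
  insertPair-removePair = lookup-ext λ b → agree b (punchInView x b)
    where
    agree : ∀ b → PunchInView x b → lookup (insertPair x a (removePair x a σ)) b ≡ lookup σ b
    agree _ at          = trans (lookup-insertPair-at x a _) (sym σx≡a)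
    agree _ (punched y) = trans (lookup-insertPair-punchIn x a _ y) (punchIn-removePair y)

insertPair-valid : ∀ {n} (x a : Fin (suc n)) {τ : Perm n} → ValidPermutation τ → ValidPermutation (insertPair x a τ)
insertPair-valid x a {τ} v = record
  { injective  = λ b c → injective′ b c (punchInView x b) (punchInView x c)
  ; surjective = λ w → preimage w (punchInView a w)
  }
  where
  open ValidPermutation v
  τ′ = insertPair x a τ
  injective′ : ∀ b c → PunchInView x b → PunchInView x c → lookup τ′ b ≡ lookup τ′ c → b ≡ c
  injective′ _ _ at at _ = refl
  injective′ _ _ at (punched z) eq = contradiction
    (trans (sym (lookup-insertPair-punchIn x a τ z)) (trans (sym eq) (lookup-insertPair-at x a τ)))
    (Fin.punchInᵢ≢i a (lookup τ z))
  injective′ _ _ (punched y) at eq = contradiction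
    (trans (sym (lookup-insertPair-punchIn x a τ y)) (trans eq (lookup-insertPair-at x a τ)))
    (Fin.punchInᵢ≢i a (lookup τ y))
  injective′ _ _ (punched y) (punched z) eq = cong (punchIn x) (injective y z (Fin.punchIn-injective a _ _
    (trans (sym (lookup-insertPair-punchIn x a τ y)) (trans eq (lookup-insertPair-punchIn x a τ z)))))
  preimage : ∀ w → PunchInView a w → ∃ λ b → lookup τ′ b ≡ w
  preimage _ at          = x , lookup-insertPair-at x a τ
  preimage _ (punched u) = let y , τy≡u = surjective u in
    punchIn x y , trans (lookup-insertPair-punchIn x a τ y) (cong (punchIn a) τy≡u)

removePair-insertPair : ∀ {n} x a (τ : Perm n) → removePair x a (insertPair x a τ) ≡ τ
removePair-insertPair x a τ = lookup-ext λ y → begin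
  lookup (removePair x a (insertPair x a τ)) y                    ≡⟨ Vec.lookup∘tabulate _ y ⟩
  punchOutOr y a (lookup (insertPair x a τ) (punchIn x y))
    ≡⟨ cong (punchOutOr y a) (lookup-insertPair-punchIn x a τ y) ⟩
  punchOutOr y a (punchIn a (lookup τ y))                         ≡⟨ punchOutOr-punchIn y a _ ⟩
  lookup τ y                                                      ∎
  where open ≡-Reasoning

IsFixed : ∀ {n} → Perm n → Fin n → Bool
IsFixed σ y = lookup σ y ==ᶠ y

IsFixed-insertPair-punchIn : ∀ {n} x (τ : Perm n) y → IsFixed (insertPair x x τ) (punchIn x y) ≡ IsFixed τ y
IsFixed-insertPair-punchIn x τ y rewrite lookup-insertPair-punchIn x x τ y = ⇔⇒≡ (mk⇔
  (Equivalence.from T-==ᶠ ∘ Fin.punchIn-injective x _ _ ∘ Equivalence.to T-==ᶠ)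
  (Equivalence.from T-==ᶠ ∘ cong (punchIn x) ∘ Equivalence.to T-==ᶠ))

fixedPointDeletion : PointDeletion
fixedPointDeletion = record
  { Structure          = Perm
  ; structures         = permutations
  ; structures-unique  = permutations-unique
  ; Marked             = IsFixed
  ; delete             = λ x → removePair x x
  ; adjoin             = λ x → insertPair x x
  ; delete-∈           = λ x σ∈ σx≡x → Equivalence.from ∈-permutations
      (removePair-valid x x (Equivalence.to ∈-permutations σ∈) (Equivalence.to T-==ᶠ σx≡x))
  ; adjoin-∈           = λ x τ∈ → Equivalence.from ∈-permutations
      (insertPair-valid x x (Equivalence.to ∈-permutations τ∈))
  ; adjoin-delete      = λ x σ∈ σx≡x →
      insertPair-removePair x x (Equivalence.to ∈-permutations σ∈) (Equivalence.to T-==ᶠ σx≡x)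
  ; delete-adjoin      = λ x → removePair-insertPair x x
  ; Marked-adjoin      = λ x τ → Equivalence.from T-==ᶠ (lookup-insertPair-at x x τ)
  ; Marked-adjoin-punchIn = IsFixed-insertPair-punchIn
  }

module PermutationsWithoutFixedPoints = Unmarked fixedPointDeletion

D≡unmarkedFrom : ∀ n → D n ≡ PermutationsWithoutFixedPoints.unmarkedFrom n 0
D≡unmarkedFrom n = sym (countᵇ-filterᵇ IsPermutation _ (allVecs (allFin n) n))

countᵇ-cartesianProductWith : ∀ {A B C : Set} (p : C → Bool) (f : A → B → C) xs ys {c} →
  (∀ x → countᵇ (p ∘ f x) ys ≡ c) → countᵇ p (cartesianProductWith f xs ys) ≡ length xs * c
countᵇ-cartesianProductWith p f []       ys fibre = refl
countᵇ-cartesianProductWith p f (x ∷ xs) ys fibre = begin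
  countᵇ p (map (f x) ys ++ cartesianProductWith f xs ys)
    ≡⟨ countᵇ-++ p (map (f x) ys) _ ⟩
  countᵇ p (map (f x) ys) + countᵇ p (cartesianProductWith f xs ys)
    ≡⟨ cong₂ _+_ (trans (countᵇ-map p (f x) ys) (fibre x)) (countᵇ-cartesianProductWith p f xs ys fibre) ⟩
  _ + length xs * _ ∎
  where open ≡-Reasoning

permutations-starting-with : ∀ {n} (a : Fin (suc n)) →
  countᵇ (IsPermutation ∘ (a ∷_)) (allVecs (allFin (suc n)) n) ≡ length (permutations n)
permutations-starting-with {n} a = countᵇ-bijection
  (λ w → removePair fzero a (a ∷ w)) (Vec.map (punchIn a))
  (allVecs-unique n (Unique.allFin⁺ (suc n))) (allVecs-unique n (Unique.allFin⁺ n))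
  (λ _ h → ∈-allVecs ∈-allFin _ , Equivalence.from (T-IsPermutation _) (removePair-valid fzero a (valid h) refl))
  (λ _ h → ∈-allVecs ∈-allFin _ , Equivalence.from (T-IsPermutation _)
                                     (insertPair-valid fzero a (Equivalence.to (T-IsPermutation _) h)))
  (λ _ h → cong Vec.tail (insertPair-removePair fzero a (valid h) refl))
  (λ _ _ → removePair-insertPair fzero a _)
  where
  valid : ∀ {w} → T (IsPermutation (a ∷ w)) → ValidPermutation (a ∷ w)
  valid = Equivalence.to (T-IsPermutation _)

length-permutations : ∀ n → length (permutations n) ≡ n !
length-permutations zero    = refl
length-permutations (suc n) = begin
  countᵇ IsPermutation (allVecs (allFin (suc n)) (suc n))
    ≡⟨ cong (countᵇ IsPermutation) (allVecs-suc (allFin (suc n)) n) ⟩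
  countᵇ IsPermutation (cartesianProductWith _∷_ (allFin (suc n)) (allVecs (allFin (suc n)) n))
    ≡⟨ countᵇ-cartesianProductWith IsPermutation _∷_ (allFin (suc n)) (allVecs (allFin (suc n)) n)
                                   permutations-starting-with ⟩
  length (allFin (suc n)) * length (permutations n)
    ≡⟨ cong₂ _*_ (List.length-tabulate {n = suc n} (λ i → i)) (length-permutations n) ⟩
  suc n * n ! ∎
  where open ≡-Reasoning

factorial≡unmarkedFrom : ∀ n → n ! ≡ PermutationsWithoutFixedPoints.unmarkedFrom n n
factorial≡unmarkedFrom n =
  sym (trans (PermutationsWithoutFixedPoints.unmarkedFrom-diagonal n) (length-permutations n))

-- Binomial convolution

∑ : ℕ → (ℕ → ℤ) → ℤ
∑ zero    g = + 0
∑ (suc m) g = g 0 +ℤ ∑ m (g ∘ suc)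

∑-cong : ∀ m {g h : ℕ → ℤ} → (∀ j → j < m → g j ≡ h j) → ∑ m g ≡ ∑ m h
∑-cong zero    eq = refl
∑-cong (suc m) eq = cong₂ _+ℤ_ (eq 0 (s≤s z≤n)) (∑-cong m (λ j j<m → eq (suc j) (s≤s j<m)))

∑-+ : ∀ m (g h : ℕ → ℤ) → ∑ m (λ j → g j +ℤ h j) ≡ ∑ m g +ℤ ∑ m h
∑-+ zero    g h = refl
∑-+ (suc m) g h = begin
  g 0 +ℤ h 0 +ℤ ∑ m (λ j → g (suc j) +ℤ h (suc j))
    ≡⟨ cong (g 0 +ℤ h 0 +ℤ_) (∑-+ m (g ∘ suc) (h ∘ suc)) ⟩
  g 0 +ℤ h 0 +ℤ (∑ m (g ∘ suc) +ℤ ∑ m (h ∘ suc))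
    ≡⟨ interchange (g 0) (h 0) _ _ ⟩
  g 0 +ℤ ∑ m (g ∘ suc) +ℤ (h 0 +ℤ ∑ m (h ∘ suc)) ∎
  where
  open ≡-Reasoning
  interchange : ∀ a b c d → a +ℤ b +ℤ (c +ℤ d) ≡ a +ℤ c +ℤ (b +ℤ d)
  interchange = solve-∀

∑-neg : ∀ m (g : ℕ → ℤ) → ∑ m (λ j → - g j) ≡ - ∑ m g
∑-neg zero    g = refl
∑-neg (suc m) g = trans (cong (- g 0 +ℤ_) (∑-neg m (g ∘ suc))) (sym (ℤ.neg-distrib-+ (g 0) _))

∑-last : ∀ m (g : ℕ → ℤ) → ∑ (suc m) g ≡ ∑ m g +ℤ g m
∑-last zero    g = ℤ.+-comm (g 0) (+ 0)
∑-last (suc m) g = trans (cong (g 0 +ℤ_) (∑-last m (g ∘ suc))) (sym (ℤ.+-assoc (g 0) _ _))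

sumToℤ≡∑ : ∀ n (g : ℕ → ℤ) → sumToℤ n g ≡ ∑ (suc n) g
sumToℤ≡∑ n g = foldr≡∑ (suc n) (λ j → j)
  where
  foldr≡∑ : ∀ m (h : ℕ → ℕ) → foldr (λ j s → g j +ℤ s) (+ 0) (applyUpTo h m) ≡ ∑ m (g ∘ h)
  foldr≡∑ zero    h = refl
  foldr≡∑ (suc m) h = cong (g (h 0) +ℤ_) (foldr≡∑ m (h ∘ suc))

+-sumTo : ∀ n (f : ℕ → ℕ) → + sumTo n f ≡ sumToℤ n (+_ ∘ f)
+-sumTo n f = +-foldr (upTo (suc n))
  where
  +-foldr : ∀ js → + foldr (λ j s → f j + s) 0 js ≡ foldr (λ j s → + f j +ℤ s) (+ 0) js
  +-foldr []       = refl
  +-foldr (j ∷ js) = trans (ℤ.pos-+ (f j) _) (cong (+ f j +ℤ_) (+-foldr js))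

nC[1+n]≡0 : ∀ n → n C suc n ≡ 0
nC[1+n]≡0 n with n <ᵇ n in n<n
... | false = refl
... | true  = contradiction (ℕ.<ᵇ⇒< n n (Equivalence.from T-≡ n<n)) (ℕ.<-irrefl refl)

infixl 7 _⋆_

convolutionTerm : (ℕ → ℤ) → (ℕ → ℤ) → ℕ → ℕ → ℤ
convolutionTerm f g n j = + (n C j) *ℤ f j *ℤ g (n ∸ j)

_⋆_ : (ℕ → ℤ) → (ℕ → ℤ) → ℕ → ℤ
(f ⋆ g) n = ∑ (suc n) (convolutionTerm f g n)

module _ (n : ℕ) where

  ⋆-congˡ : ∀ {f f′} g → (∀ j → j ≤ n → f j ≡ f′ j) → (f ⋆ g) n ≡ (f′ ⋆ g) n
  ⋆-congˡ g eq = ∑-cong (suc n) λ j j≤n → cong (λ z → + (n C j) *ℤ z *ℤ g (n ∸ j)) (eq j (s≤s⁻¹ j≤n))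

  ⋆-congʳ : ∀ f {g g′} → (∀ j → j ≤ n → g j ≡ g′ j) → (f ⋆ g) n ≡ (f ⋆ g′) n
  ⋆-congʳ f eq = ∑-cong (suc n) λ j _ → cong (+ (n C j) *ℤ f j *ℤ_) (eq (n ∸ j) (ℕ.m∸n≤m n j))

  ⋆-+ˡ : ∀ f f′ g → ((λ j → f j +ℤ f′ j) ⋆ g) n ≡ (f ⋆ g) n +ℤ (f′ ⋆ g) n
  ⋆-+ˡ f f′ g = trans (∑-cong (suc n) λ j _ → distrib (+ (n C j)) (f j) (f′ j) (g (n ∸ j)))
                      (∑-+ (suc n) (convolutionTerm f g n) (convolutionTerm f′ g n))
    where
    distrib : ∀ c a b d → c *ℤ (a +ℤ b) *ℤ d ≡ c *ℤ a *ℤ d +ℤ c *ℤ b *ℤ d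
    distrib = solve-∀

  ⋆-+ʳ : ∀ f g g′ → (f ⋆ (λ j → g j +ℤ g′ j)) n ≡ (f ⋆ g) n +ℤ (f ⋆ g′) n
  ⋆-+ʳ f g g′ = trans (∑-cong (suc n) λ j _ → distrib (+ (n C j)) (f j) (g (n ∸ j)) (g′ (n ∸ j)))
                      (∑-+ (suc n) (convolutionTerm f g n) (convolutionTerm f g′ n))
    where
    distrib : ∀ c a b d → c *ℤ a *ℤ (b +ℤ d) ≡ c *ℤ a *ℤ b +ℤ c *ℤ a *ℤ d
    distrib = solve-∀

  ⋆-negˡ : ∀ f g → ((λ j → - f j) ⋆ g) n ≡ - (f ⋆ g) n
  ⋆-negˡ f g = trans (∑-cong (suc n) λ j _ → neg-inside (+ (n C j)) (f j) (g (n ∸ j)))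
                     (∑-neg (suc n) (convolutionTerm f g n))
    where
    neg-inside : ∀ c a b → c *ℤ (- a) *ℤ b ≡ - (c *ℤ a *ℤ b)
    neg-inside = solve-∀

  ⋆-negʳ : ∀ f g → (f ⋆ (λ j → - g j)) n ≡ - (f ⋆ g) n
  ⋆-negʳ f g = trans (∑-cong (suc n) λ j _ → neg-inside (+ (n C j)) (f j) (g (n ∸ j)))
                     (∑-neg (suc n) (convolutionTerm f g n))
    where
    neg-inside : ∀ c a b → c *ℤ a *ℤ (- b) ≡ - (c *ℤ a *ℤ b)
    neg-inside = solve-∀

-- Leibniz rule: the convolution behaves like the product of exponential
-- generating functions, for which the shift f ↦ f ∘ suc is differentiation.
⋆-suc : ∀ n f g → (f ⋆ g) (suc n) ≡ ((f ∘ suc) ⋆ g) n +ℤ (f ⋆ (g ∘ suc)) n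
⋆-suc n f g = begin
  (f ⋆ g) (suc n)
    ≡⟨⟩
  first +ℤ ∑ (suc n) (λ j → + (suc n C suc j) *ℤ f (suc j) *ℤ g (n ∸ j))
    ≡⟨ cong (first +ℤ_) (trans (∑-cong (suc n) (λ j _ → pascal j))
                               (∑-+ (suc n) (convolutionTerm (f ∘ suc) g n) upper)) ⟩
  first +ℤ (((f ∘ suc) ⋆ g) n +ℤ ∑ (suc n) upper)
    ≡⟨ cong (λ z → first +ℤ (((f ∘ suc) ⋆ g) n +ℤ z)) upper-sum ⟩
  first +ℤ (((f ∘ suc) ⋆ g) n +ℤ ∑ n (λ j → + (n C suc j) *ℤ f (suc j) *ℤ g (suc (n ∸ suc j))))
    ≡⟨ swap first (((f ∘ suc) ⋆ g) n) _ ⟩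
  ((f ∘ suc) ⋆ g) n +ℤ (f ⋆ (g ∘ suc)) n ∎
  where
  open ≡-Reasoning
  first = + 1 *ℤ f 0 *ℤ g (suc n)
  upper = λ j → + (n C suc j) *ℤ f (suc j) *ℤ g (n ∸ j)
  pascal : ∀ j → + (suc n C suc j) *ℤ f (suc j) *ℤ g (n ∸ j)
               ≡ + (n C j) *ℤ f (suc j) *ℤ g (n ∸ j) +ℤ upper j
  pascal j = begin
    + (suc n C suc j) *ℤ f (suc j) *ℤ g (n ∸ j)
      ≡⟨ cong (λ c → + c *ℤ f (suc j) *ℤ g (n ∸ j)) (sym (nCk+nC[k+1]≡[n+1]C[k+1] n j)) ⟩
    + (n C j + n C suc j) *ℤ f (suc j) *ℤ g (n ∸ j)
      ≡⟨ cong (λ c → c *ℤ f (suc j) *ℤ g (n ∸ j)) (ℤ.pos-+ (n C j) _) ⟩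
    (+ (n C j) +ℤ + (n C suc j)) *ℤ f (suc j) *ℤ g (n ∸ j)
      ≡⟨ distrib (+ (n C j)) (+ (n C suc j)) (f (suc j)) (g (n ∸ j)) ⟩
    + (n C j) *ℤ f (suc j) *ℤ g (n ∸ j) +ℤ upper j ∎
    where
    distrib : ∀ a b c d → (a +ℤ b) *ℤ c *ℤ d ≡ a *ℤ c *ℤ d +ℤ b *ℤ c *ℤ d
    distrib = solve-∀
  upper-sum : ∑ (suc n) upper ≡ ∑ n (λ j → + (n C suc j) *ℤ f (suc j) *ℤ g (suc (n ∸ suc j)))
  upper-sum = begin
    ∑ (suc n) upper
      ≡⟨ ∑-last n upper ⟩
    ∑ n upper +ℤ upper n
      ≡⟨ cong (λ c → ∑ n upper +ℤ + c *ℤ f (suc n) *ℤ g (n ∸ n)) (nC[1+n]≡0 n) ⟩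
    ∑ n upper +ℤ + 0 *ℤ f (suc n) *ℤ g (n ∸ n)
      ≡⟨ vanish (∑ n upper) (f (suc n)) (g (n ∸ n)) ⟩
    ∑ n upper
      ≡⟨ ∑-cong n (λ j j<n → cong (λ i → + (n C suc j) *ℤ f (suc j) *ℤ g i) (ℕ.+-∸-assoc 1 j<n)) ⟩
    ∑ n (λ j → + (n C suc j) *ℤ f (suc j) *ℤ g (suc (n ∸ suc j))) ∎
    where
    vanish : ∀ s a b → s +ℤ + 0 *ℤ a *ℤ b ≡ s
    vanish = solve-∀
  swap : ∀ a b c → a +ℤ (b +ℤ c) ≡ b +ℤ (a +ℤ c)
  swap = solve-∀

⋆-comm : ∀ n f g → (f ⋆ g) n ≡ (g ⋆ f) n
⋆-comm zero    f g = swap (f 0) (g 0)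
  where
  swap : ∀ a b → + 1 *ℤ a *ℤ b +ℤ + 0 ≡ + 1 *ℤ b *ℤ a +ℤ + 0
  swap = solve-∀
⋆-comm (suc n) f g = begin
  (f ⋆ g) (suc n)                         ≡⟨ ⋆-suc n f g ⟩
  ((f ∘ suc) ⋆ g) n +ℤ (f ⋆ (g ∘ suc)) n  ≡⟨ cong₂ _+ℤ_ (⋆-comm n (f ∘ suc) g) (⋆-comm n f (g ∘ suc)) ⟩
  (g ⋆ (f ∘ suc)) n +ℤ ((g ∘ suc) ⋆ f) n  ≡⟨ ℤ.+-comm ((g ⋆ (f ∘ suc)) n) _ ⟩
  ((g ∘ suc) ⋆ f) n +ℤ (g ⋆ (f ∘ suc)) n  ≡⟨ ⋆-suc n g f ⟨
  (g ⋆ f) (suc n)                         ∎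
  where open ≡-Reasoning

⋆-assoc : ∀ n f g h → ((f ⋆ g) ⋆ h) n ≡ (f ⋆ (g ⋆ h)) n
⋆-assoc zero    f g h = reassoc (f 0) (g 0) (h 0)
  where
  reassoc : ∀ a b c →
    + 1 *ℤ (+ 1 *ℤ a *ℤ b +ℤ + 0) *ℤ c +ℤ + 0 ≡ + 1 *ℤ a *ℤ (+ 1 *ℤ b *ℤ c +ℤ + 0) +ℤ + 0
  reassoc = solve-∀
⋆-assoc (suc n) f g h = begin
  ((f ⋆ g) ⋆ h) (suc n)
    ≡⟨ ⋆-suc n (f ⋆ g) h ⟩
  (((f ⋆ g) ∘ suc) ⋆ h) n +ℤ ((f ⋆ g) ⋆ h′) n
    ≡⟨ cong (_+ℤ ((f ⋆ g) ⋆ h′) n)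
            (trans (⋆-congˡ n h (λ j _ → ⋆-suc j f g)) (⋆-+ˡ n (f′ ⋆ g) (f ⋆ g′) h)) ⟩
  ((f′ ⋆ g) ⋆ h) n +ℤ ((f ⋆ g′) ⋆ h) n +ℤ ((f ⋆ g) ⋆ h′) n
    ≡⟨ cong₂ _+ℤ_ (cong₂ _+ℤ_ (⋆-assoc n f′ g h) (⋆-assoc n f g′ h)) (⋆-assoc n f g h′) ⟩
  (f′ ⋆ (g ⋆ h)) n +ℤ (f ⋆ (g′ ⋆ h)) n +ℤ (f ⋆ (g ⋆ h′)) n
    ≡⟨ ℤ.+-assoc ((f′ ⋆ (g ⋆ h)) n) _ _ ⟩
  (f′ ⋆ (g ⋆ h)) n +ℤ ((f ⋆ (g′ ⋆ h)) n +ℤ (f ⋆ (g ⋆ h′)) n)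
    ≡⟨ cong ((f′ ⋆ (g ⋆ h)) n +ℤ_)
            (trans (⋆-congʳ n f (λ j _ → ⋆-suc j g h)) (⋆-+ʳ n f (g′ ⋆ h) (g ⋆ h′))) ⟨
  (f′ ⋆ (g ⋆ h)) n +ℤ (f ⋆ ((g ⋆ h) ∘ suc)) n
    ≡⟨ ⋆-suc n f (g ⋆ h) ⟨
  (f ⋆ (g ⋆ h)) (suc n) ∎
  where
  open ≡-Reasoning
  f′ = f ∘ suc
  g′ = g ∘ suc
  h′ = h ∘ suc

one : ℕ → ℤ
one _ = + 1

column⋆one≡diagonal : ∀ {f} → PascalRecurrence f → ∀ N k →
  ((λ j → + f (k + j) k) ⋆ one) N ≡ + f (k + N) (k + N)
column⋆one≡diagonal {f} pascal zero k = begin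
  + 1 *ℤ + f (k + 0) k *ℤ + 1 +ℤ + 0   ≡⟨ unit (+ f (k + 0) k) ⟩
  + f (k + 0) k                        ≡⟨ cong (λ i → + f (k + 0) i) (ℕ.+-identityʳ k) ⟨
  + f (k + 0) (k + 0)                  ∎
  where
  open ≡-Reasoning
  unit : ∀ a → + 1 *ℤ a *ℤ + 1 +ℤ + 0 ≡ a
  unit = solve-∀
column⋆one≡diagonal {f} pascal (suc N) k = begin
  ((λ j → + f (k + j) k) ⋆ one) (suc N)
    ≡⟨ ⋆-suc N (λ j → + f (k + j) k) one ⟩
  ((λ j → + f (k + suc j) k) ⋆ one) N +ℤ ((λ j → + f (k + j) k) ⋆ one) N
    ≡⟨ ⋆-+ˡ N (λ j → + f (k + suc j) k) (λ j → + f (k + j) k) one ⟨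
  ((λ j → + f (k + suc j) k +ℤ + f (k + j) k) ⋆ one) N
    ≡⟨ ⋆-congˡ N one (λ j _ → next-column j) ⟩
  ((λ j → + f (suc k + j) (suc k)) ⋆ one) N
    ≡⟨ column⋆one≡diagonal {f} pascal N (suc k) ⟩
  + f (suc k + N) (suc k + N)
    ≡⟨ cong (λ i → + f i i) (ℕ.+-suc k N) ⟨
  + f (k + suc N) (k + suc N) ∎
  where
  open ≡-Reasoning
  next-column : ∀ j → + f (k + suc j) k +ℤ + f (k + j) k ≡ + f (suc k + j) (suc k)
  next-column j rewrite ℕ.+-suc k j =
    trans (sym (ℤ.pos-+ (f (suc (k + j)) k) (f (k + j) k))) (cong +_ (sym (pascal (ℕ.m≤m+n k j))))

sign : ℕ → ℤ
sign m = (- + 1) ^ℤ m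

⋆-sign-suc : ∀ n f → (f ⋆ sign) (suc n) ≡ ((f ∘ suc) ⋆ sign) n -ℤ (f ⋆ sign) n
⋆-sign-suc n f = begin
  (f ⋆ sign) (suc n)                                ≡⟨ ⋆-suc n f sign ⟩
  ((f ∘ suc) ⋆ sign) n +ℤ (f ⋆ (sign ∘ suc)) n
    ≡⟨ cong (((f ∘ suc) ⋆ sign) n +ℤ_) (⋆-congʳ n f (λ j _ → ℤ.-1*i≡-i (sign j))) ⟩
  ((f ∘ suc) ⋆ sign) n +ℤ (f ⋆ (λ j → - sign j)) n
    ≡⟨ cong (((f ∘ suc) ⋆ sign) n +ℤ_) (⋆-negʳ n f sign) ⟩
  ((f ∘ suc) ⋆ sign) n -ℤ (f ⋆ sign) n              ∎
  where open ≡-Reasoning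

+-sumTo-binomial : ∀ n (a b : ℕ → ℕ) →
  + sumTo n (λ j → (n C j) * a j * b (n ∸ j)) ≡ ((+_ ∘ a) ⋆ (+_ ∘ b)) n
+-sumTo-binomial n a b = trans (+-sumTo n term) (trans (sumToℤ≡∑ n (+_ ∘ term)) (∑-cong (suc n) λ j _ →
  trans (ℤ.pos-* ((n C j) * a j) (b (n ∸ j))) (cong (_*ℤ + b (n ∸ j)) (ℤ.pos-* (n C j) (a j)))))
  where
  term = λ j → (n C j) * a j * b (n ∸ j)

sumToℤ-alternating-binomial : ∀ n (a b : ℕ → ℕ) →
  sumToℤ n (λ j → sign (n ∸ j) *ℤ + ((n C j) * a j * b j)) ≡ ((λ j → + (a j * b j)) ⋆ sign) n
sumToℤ-alternating-binomial n a b =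
  trans (sumToℤ≡∑ n (λ j → sign (n ∸ j) *ℤ + ((n C j) * a j * b j))) (∑-cong (suc n) λ j _ → begin
  sign (n ∸ j) *ℤ + ((n C j) * a j * b j)
    ≡⟨ cong (sign (n ∸ j) *ℤ_)
            (trans (ℤ.pos-* ((n C j) * a j) (b j)) (cong (_*ℤ + b j) (ℤ.pos-* (n C j) (a j)))) ⟩
  sign (n ∸ j) *ℤ (+ (n C j) *ℤ + a j *ℤ + b j)
    ≡⟨ rearrange (sign (n ∸ j)) (+ (n C j)) (+ a j) (+ b j) ⟩
  + (n C j) *ℤ (+ a j *ℤ + b j) *ℤ sign (n ∸ j)
    ≡⟨ cong (λ z → + (n C j) *ℤ z *ℤ sign (n ∸ j)) (ℤ.pos-* (a j) (b j)) ⟨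
  + (n C j) *ℤ + (a j * b j) *ℤ sign (n ∸ j) ∎)
  where
  open ≡-Reasoning
  rearrange : ∀ s c x y → s *ℤ (c *ℤ x *ℤ y) ≡ c *ℤ (x *ℤ y) *ℤ s
  rearrange = solve-∀

A⋆one≡Bell : ∀ k N → ((λ j → + A (k + j) k) ⋆ one) N ≡ + Bell (k + N)
A⋆one≡Bell k N = trans (column⋆one≡diagonal {A} A-pascal N k) (cong +_ (A-diagonal (k + N)))

one⋆D≡factorial : ∀ N → (one ⋆ (+_ ∘ D)) N ≡ + (N !)
one⋆D≡factorial N = begin
  (one ⋆ (+_ ∘ D)) N
    ≡⟨ ⋆-comm N one (+_ ∘ D) ⟩
  ((+_ ∘ D) ⋆ one) N
    ≡⟨ ⋆-congˡ N one (λ j _ → cong +_ (D≡unmarkedFrom j)) ⟩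
  ((λ j → + unmarkedFrom j 0) ⋆ one) N
    ≡⟨ column⋆one≡diagonal {unmarkedFrom} unmarkedFrom-pascal N 0 ⟩
  + unmarkedFrom N N
    ≡⟨ cong +_ (factorial≡unmarkedFrom N) ⟨
  + (N !) ∎
  where
  open ≡-Reasoning
  open PermutationsWithoutFixedPoints

A⋆factorial≡Bell⋆D : ∀ n k →
  ((λ j → + A (k + j) k) ⋆ (+_ ∘ _!)) n ≡ ((λ j → + Bell (k + j)) ⋆ (+_ ∘ D)) n
A⋆factorial≡Bell⋆D n k = begin
  (a ⋆ (+_ ∘ _!)) n        ≡⟨ ⋆-congʳ n a (λ j _ → one⋆D≡factorial j) ⟨
  (a ⋆ (one ⋆ d)) n        ≡⟨ ⋆-assoc n a one d ⟨
  ((a ⋆ one) ⋆ d) n        ≡⟨ ⋆-congˡ n d (λ j _ → A⋆one≡Bell k j) ⟩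
  ((λ j → + Bell (k + j)) ⋆ d) n ∎
  where
  open ≡-Reasoning
  a = λ j → + A (k + j) k
  d = +_ ∘ D

alternatingAA : ℕ → ℕ → ℕ → ℕ → ℤ
alternatingAA n k m i = ((λ j → + (A (k + j) k * A (m + i + j) m)) ⋆ sign) n

alternatingABell : ℕ → ℕ → ℕ → ℕ → ℤ
alternatingABell n k m i = ((λ j → + (A (n + m + i) (n + m ∸ j) * Bell (k + j))) ⋆ sign) n

alternatingAA-suc : ∀ n k m i → alternatingAA (suc n) k m i ≡
  alternatingAA n (suc k) m (suc i) -ℤ alternatingAA n k m (suc i) -ℤ alternatingAA n k m i
alternatingAA-suc n k m i = begin
  alternatingAA (suc n) k m i
    ≡⟨ ⋆-sign-suc n (λ j → + (A (k + j) k * A (m + i + j) m)) ⟩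
  ((λ j → + (A (k + suc j) k * A (m + i + suc j) m)) ⋆ sign) n -ℤ alternatingAA n k m i
    ≡⟨ cong (_-ℤ alternatingAA n k m i) (trans (⋆-congˡ n sign (λ j _ → shifted j))
         (⋆-+ˡ n (λ j → + (A (suc k + j) (suc k) * A (m + suc i + j) m)) (λ j → - AA j) sign)) ⟩
  alternatingAA n (suc k) m (suc i) +ℤ ((λ j → - AA j) ⋆ sign) n -ℤ alternatingAA n k m i
    ≡⟨ cong (λ z → alternatingAA n (suc k) m (suc i) +ℤ z -ℤ alternatingAA n k m i) (⋆-negˡ n AA sign) ⟩
  alternatingAA n (suc k) m (suc i) -ℤ alternatingAA n k m (suc i) -ℤ alternatingAA n k m i ∎
  where
  open ≡-Reasoning
  AA = λ j → + (A (k + j) k * A (m + suc i + j) m)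
  shifted : ∀ j → + (A (k + suc j) k * A (m + i + suc j) m)
                ≡ + (A (suc k + j) (suc k) * A (m + suc i + j) m) -ℤ + (A (k + j) k * A (m + suc i + j) m)
  shifted j rewrite ℕ.+-suc k j | ℕ.+-suc (m + i) j | ℕ.+-suc m i = begin
    + (P * B)
      ≡⟨ add-sub (+ (P * B)) (+ (Q * B)) ⟩
    + (P * B) +ℤ + (Q * B) -ℤ + (Q * B)
      ≡⟨ cong (_-ℤ + (Q * B)) (trans (sym (ℤ.pos-+ (P * B) (Q * B))) (cong +_ (sym (ℕ.*-distribʳ-+ B P Q)))) ⟩
    + ((P + Q) * B) -ℤ + (Q * B)
      ≡⟨ cong (λ z → + (z * B) -ℤ + (Q * B)) (A-pascal (ℕ.m≤m+n k j)) ⟨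
    + (A (suc (k + j)) (suc k) * B) -ℤ + (Q * B) ∎
    where
    P = A (suc (k + j)) k
    Q = A (k + j) k
    B = A (suc (m + i + j)) m
    add-sub : ∀ x y → x ≡ x +ℤ y -ℤ y
    add-sub = solve-∀

alternatingABell-suc : ∀ n k m i → alternatingABell (suc n) k m i ≡
  alternatingABell n (suc k) m (suc i) -ℤ (alternatingABell n k m (suc i) +ℤ alternatingABell n k m i)
alternatingABell-suc n k m i = begin
  alternatingABell (suc n) k m i
    ≡⟨ ⋆-sign-suc n x ⟩
  ((x ∘ suc) ⋆ sign) n -ℤ (x ⋆ sign) n
    ≡⟨ cong₂ _-ℤ_ (⋆-congˡ n sign λ j _ → shifted j)
                  (trans (⋆-congˡ n sign split) (⋆-+ˡ n (ABell (n + m + suc i)) (ABell (n + m + i)) sign)) ⟩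
  alternatingABell n (suc k) m (suc i) -ℤ (alternatingABell n k m (suc i) +ℤ alternatingABell n k m i) ∎
  where
  open ≡-Reasoning
  x = λ j → + (A (suc n + m + i) (suc n + m ∸ j) * Bell (k + j))
  ABell = λ N j → + (A N (n + m ∸ j) * Bell (k + j))
  shifted : ∀ j → x (suc j) ≡ + (A (n + m + suc i) (n + m ∸ j) * Bell (suc k + j))
  shifted j rewrite ℕ.+-suc k j | ℕ.+-suc (n + m) i = refl
  split : ∀ j → j ≤ n → x j ≡ ABell (n + m + suc i) j +ℤ ABell (n + m + i) j
  split j j≤n = begin
    + (A (suc (n + m + i)) (suc n + m ∸ j) * Bell (k + j))
      ≡⟨ cong (λ K → + (A (suc (n + m + i)) K * Bell (k + j)))
              (ℕ.+-∸-assoc 1 (ℕ.≤-trans j≤n (ℕ.m≤m+n n m))) ⟩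
    + (A (suc (n + m + i)) (suc (n + m ∸ j)) * Bell (k + j))
      ≡⟨ cong (λ a → + (a * Bell (k + j)))
              (A-pascal (ℕ.≤-trans (ℕ.m∸n≤m (n + m) j) (ℕ.m≤m+n (n + m) i))) ⟩
    + ((A (suc (n + m + i)) (n + m ∸ j) + A (n + m + i) (n + m ∸ j)) * Bell (k + j))
      ≡⟨ cong +_ (ℕ.*-distribʳ-+ (Bell (k + j)) (A (suc (n + m + i)) (n + m ∸ j)) (A (n + m + i) (n + m ∸ j))) ⟩
    + (A (suc (n + m + i)) (n + m ∸ j) * Bell (k + j) + A (n + m + i) (n + m ∸ j) * Bell (k + j))
      ≡⟨ ℤ.pos-+ (A (suc (n + m + i)) (n + m ∸ j) * Bell (k + j)) _ ⟩
    + (A (suc (n + m + i)) (n + m ∸ j) * Bell (k + j)) +ℤ ABell (n + m + i) j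
      ≡⟨ cong (λ N → + (A N (n + m ∸ j) * Bell (k + j)) +ℤ ABell (n + m + i) j) (ℕ.+-suc (n + m) i) ⟨
    ABell (n + m + suc i) j +ℤ ABell (n + m + i) j ∎

alternatingAA≡alternatingABell : ∀ n k m i → alternatingAA n k m i ≡ alternatingABell n k m i
alternatingAA≡alternatingABell zero k m i =
  ⋆-congˡ 0 {λ j → + (A (k + j) k * A (m + i + j) m)} {λ j → + (A (m + i) (m ∸ j) * Bell (k + j))} sign
    λ { zero _ → cong +_ base }
  where
  open ≡-Reasoning
  base : A (k + 0) k * A (m + i + 0) m ≡ A (m + i) m * Bell (k + 0)
  base = begin
    A (k + 0) k * A (m + i + 0) m
      ≡⟨ cong₂ (λ k′ mi → A k′ k * A mi m) (ℕ.+-identityʳ k) (ℕ.+-identityʳ (m + i)) ⟩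
    A k k * A (m + i) m             ≡⟨ cong (_* A (m + i) m) (A-diagonal k) ⟩
    Bell k * A (m + i) m            ≡⟨ ℕ.*-comm (Bell k) (A (m + i) m) ⟩
    A (m + i) m * Bell k            ≡⟨ cong (λ k′ → A (m + i) m * Bell k′) (ℕ.+-identityʳ k) ⟨
    A (m + i) m * Bell (k + 0)      ∎
alternatingAA≡alternatingABell (suc n) k m i = begin
  alternatingAA (suc n) k m i
    ≡⟨ alternatingAA-suc n k m i ⟩
  alternatingAA n (suc k) m (suc i) -ℤ alternatingAA n k m (suc i) -ℤ alternatingAA n k m i
    ≡⟨ cong₂ _-ℤ_ (cong₂ _-ℤ_ (IH (suc k) (suc i)) (IH k (suc i))) (IH k i) ⟩
  alternatingABell n (suc k) m (suc i) -ℤ alternatingABell n k m (suc i) -ℤ alternatingABell n k m i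
    ≡⟨ sub-sub (alternatingABell n (suc k) m (suc i)) (alternatingABell n k m (suc i)) (alternatingABell n k m i) ⟩
  alternatingABell n (suc k) m (suc i) -ℤ (alternatingABell n k m (suc i) +ℤ alternatingABell n k m i)
    ≡⟨ alternatingABell-suc n k m i ⟨
  alternatingABell (suc n) k m i ∎
  where
  open ≡-Reasoning
  IH = λ k′ i′ → alternatingAA≡alternatingABell n k′ m i′
  sub-sub : ∀ a b c → a -ℤ b -ℤ c ≡ a -ℤ (b +ℤ c)
  sub-sub = solve-∀

corollary3p8 : (n k m i : ℕ) →
    (sumTo n (λ j → (n C j) * A (k + j) k * (n ∸ j) !)
      ≡ sumTo n (λ j → (n C j) * Bell (k + j) * D (n ∸ j)))
    × (sumToℤ n (λ j → ((- + 1) ^ℤ (n ∸ j)) *ℤ + ((n C j) * A (k + j) k * A (m + i + j) m))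
      ≡ sumToℤ n (λ j → ((- + 1) ^ℤ (n ∸ j)) *ℤ + ((n C j) * A (n + m + i) (n + m ∸ j) * Bell (k + j))))
corollary3p8 n k m i = ℤ.+-injective first , second
  where
  open ≡-Reasoning
  first = begin
    + sumTo n (λ j → (n C j) * A (k + j) k * (n ∸ j) !)    ≡⟨ +-sumTo-binomial n (λ j → A (k + j) k) _! ⟩
    ((λ j → + A (k + j) k) ⋆ (+_ ∘ _!)) n                  ≡⟨ A⋆factorial≡Bell⋆D n k ⟩
    ((λ j → + Bell (k + j)) ⋆ (+_ ∘ D)) n                  ≡⟨ +-sumTo-binomial n (λ j → Bell (k + j)) D ⟨
    + sumTo n (λ j → (n C j) * Bell (k + j) * D (n ∸ j))   ∎
  second = begin
    sumToℤ n (λ j → sign (n ∸ j) *ℤ + ((n C j) * A (k + j) k * A (m + i + j) m))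
      ≡⟨ sumToℤ-alternating-binomial n (λ j → A (k + j) k) (λ j → A (m + i + j) m) ⟩
    alternatingAA n k m i
      ≡⟨ alternatingAA≡alternatingABell n k m i ⟩
    alternatingABell n k m i
      ≡⟨ sumToℤ-alternating-binomial n (λ j → A (n + m + i) (n + m ∸ j)) (λ j → Bell (k + j)) ⟨
    sumToℤ n (λ j → sign (n ∸ j) *ℤ + ((n C j) * A (n + m + i) (n + m ∸ j) * Bell (k + j))) ∎
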